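{- Let $c$ be a finite set of jobs with processing times $p_j\ge 0$ such that $3/4\le p(c)\le 1$ and $\max_{j\in c}p_j\le 3/4$. Then $c$ can be partitioned into two parts $\check c$ and $\hat c$ with $p(\check c)\le 1/2$, $p(\hat c)\le 3/4$ and $p(\check c)\le p(\hat c)$. Furthermore, if $\max_{j\in c}p_j\le 1/2$, the partition can be chosen such that additionally $p(\check c)\in(1/4,1/2]$ or $p(\hat c)\in(1/4,1/2]$.
   Context: For a set $X$ of jobs, $p(X)$ denotes the sum of the processing times of the jobs in $X$.
   Formalization: The processing times $p_j$ of the jobs are rational numbers. -}

module Defs where

open import Data.Nat using (ℕ; zero; suc)
open import Data.Fin using (Fin; zero; suc)
open import Data.Bool using (Bool; true; false; if_then_else_; not)
open import Data.Integer using (+_)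
open import Data.Rational using (ℚ; 0ℚ; _+_; _/_; _≤_; _<_)
open import Data.Product using (_×_)

sumFin : (n : ℕ) → (Fin n → ℚ) → ℚ
sumFin zero    f = 0ℚ
sumFin (suc n) f = f zero + sumFin n (λ i → f (suc i))

load : {n : ℕ} → (Fin n → ℚ) → (Fin n → Bool) → ℚ
load {n} p X = sumFin n (λ i → if X i then p i else 0ℚ)

total : {n : ℕ} → (Fin n → ℚ) → ℚ
total {n} p = sumFin n p

compl : {n : ℕ} → (Fin n → Bool) → (Fin n → Bool)
compl X i = not (X i)

¼ ¾ : ℚ
¼ = + 1 / 4
¾ = + 3 / 4

InQuarterHalf : ℚ → Set
InQuarterHalf x = (¼ < x) × (x ≤ + 1 / 2)

module Submission where

-- Greedily scan the jobs: as long as the jobs seen so far weigh at most ¼, either the next job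
-- alone is heavier than ¼, or adding it keeps the total at most ½; so some set of jobs has load
-- in (¼, b] for any bound b ≥ ½ on the job sizes.  Such a set and its complement both weigh at
-- most ¾ (the total is at most 1), and the lighter of the two then weighs at most ½.

open import Defs
open import Data.Nat using (ℕ; zero; suc)
open import Data.Fin using (Fin; zero; suc)
open import Data.Bool using (Bool; true; false; not; if_then_else_)
open import Data.Rational using (ℚ; 0ℚ; 1ℚ; ½; _≤_; _<_; _+_)
open import Data.Rational.Properties
open import Data.Product using (Σ-syntax; _×_; _,_)
open import Data.Sum using (_⊎_; inj₁; inj₂)
open import Data.Unit using (tt)
open import Data.Empty using (⊥-elim)
open import Data.Vec.Functional using (_∷_)
open import Function using (_∘_; const)
open import Relation.Nullary using (yes; no)
open import Relation.Nullary.Decidable using (toWitness)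
open import Relation.Binary.PropositionalEquality

x≤y∧x+y≤z+z⇒x≤z : ∀ {x y z : ℚ} → x ≤ y → x + y ≤ z + z → x ≤ z
x≤y∧x+y≤z+z⇒x≤z x≤y x+y≤z+z = ≮⇒≥ λ z<x →
  <-irrefl refl (<-≤-trans (+-mono-< z<x (<-≤-trans z<x x≤y)) x+y≤z+z)

x<y∧y+z≤x+w⇒z≤w : ∀ {x y z w : ℚ} → x < y → y + z ≤ x + w → z ≤ w
x<y∧y+z≤x+w⇒z≤w x<y y+z≤x+w = ≮⇒≥ λ w<z →
  <-irrefl refl (<-≤-trans (+-mono-< x<y w<z) y+z≤x+w)

sumFin-cong : ∀ n {f g : Fin n → ℚ} → (∀ i → f i ≡ g i) → sumFin n f ≡ sumFin n g
sumFin-cong zero    f≗g = refl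
sumFin-cong (suc n) f≗g = cong₂ _+_ (f≗g zero) (sumFin-cong n (f≗g ∘ suc))

sumFin-0 : ∀ n → sumFin n (const 0ℚ) ≡ 0ℚ
sumFin-0 zero    = refl
sumFin-0 (suc n) = trans (+-identityˡ _) (sumFin-0 n)

+-interchange : (a b c d : ℚ) → (a + b) + (c + d) ≡ (a + c) + (b + d)
+-interchange a b c d = begin
  (a + b) + (c + d) ≡⟨ +-assoc a b (c + d) ⟩
  a + (b + (c + d)) ≡⟨ cong (a +_) (sym (+-assoc b c d)) ⟩
  a + ((b + c) + d) ≡⟨ cong (λ t → a + (t + d)) (+-comm b c) ⟩
  a + ((c + b) + d) ≡⟨ cong (a +_) (+-assoc c b d) ⟩
  a + (c + (b + d)) ≡⟨ sym (+-assoc a c (b + d)) ⟩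
  (a + c) + (b + d) ∎
  where open ≡-Reasoning

load-+-compl : ∀ {n} (p : Fin n → ℚ) (A : Fin n → Bool) → load p A + load p (compl A) ≡ total p
load-+-compl {zero}  p A = refl
load-+-compl {suc n} p A =
  trans (+-interchange (job (A zero)) (load (p ∘ suc) (A ∘ suc))
                       (job (not (A zero))) (load (p ∘ suc) (compl (A ∘ suc))))
        (cong₂ _+_ (job+job-not (A zero)) (load-+-compl (p ∘ suc) (A ∘ suc)))
  where
  job : Bool → ℚ
  job b = if b then p zero else 0ℚ
  job+job-not : ∀ b → job b + job (not b) ≡ p zero
  job+job-not true  = +-identityʳ (p zero)
  job+job-not false = +-identityˡ (p zero)

load-compl-compl : ∀ {n} (p : Fin n → ℚ) (A : Fin n → Bool) → load p (compl (compl A)) ≡ load p A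
load-compl-compl {n} p A = sumFin-cong n (λ i → job-not-not i (A i))
  where
  job-not-not : ∀ i b → (if not (not b) then p i else 0ℚ) ≡ (if b then p i else 0ℚ)
  job-not-not i true  = refl
  job-not-not i false = refl

load-singleton : ∀ {n} (p : Fin (suc n) → ℚ) → load p (true ∷ const false) ≡ p zero
load-singleton {n} p = trans (cong (p zero +_) (sumFin-0 n)) (+-identityʳ (p zero))

total≤⊎∃load∈window : ∀ {ℓ b} → 0ℚ ≤ ℓ → ℓ + ℓ ≤ b → ∀ {n} (p : Fin n → ℚ) → (∀ j → p j ≤ b)
  → total p ≤ ℓ ⊎ Σ[ A ∈ (Fin n → Bool) ] (ℓ < load p A × load p A ≤ b)
total≤⊎∃load∈window 0≤ℓ ℓ+ℓ≤b {zero} p p≤b = inj₁ 0≤ℓ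
total≤⊎∃load∈window {ℓ} {b} 0≤ℓ ℓ+ℓ≤b {suc n} p p≤b
  with total≤⊎∃load∈window 0≤ℓ ℓ+ℓ≤b (p ∘ suc) (p≤b ∘ suc)
... | inj₂ (A , ℓ<A , A≤b) =
  inj₂ (false ∷ A , subst (ℓ <_) (sym (+-identityˡ _)) ℓ<A
                       , subst (_≤ b) (sym (+-identityˡ _)) A≤b)
... | inj₁ rest≤ℓ with ℓ <? p zero
...   | yes ℓ<p₀ = inj₂ (true ∷ const false , subst (ℓ <_) (sym (load-singleton p)) ℓ<p₀
                           , subst (_≤ b) (sym (load-singleton p)) (p≤b zero))
...   | no ℓ≮p₀ with total p ≤? ℓ
...     | yes total≤ℓ = inj₁ total≤ℓ
...     | no total≰ℓ  = inj₂ (const true , ≰⇒> total≰ℓ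
                             , ≤-trans (+-mono-≤ (≮⇒≥ ℓ≮p₀) rest≤ℓ) ℓ+ℓ≤b)

Balanced : ∀ {n} → (Fin n → ℚ) → (Fin n → Bool) → Set
Balanced p S = load p S ≤ ½ × load p (compl S) ≤ ¾ × load p S ≤ load p (compl S)

module _ {n} (p : Fin n → ℚ) (total≤1 : total p ≤ 1ℚ) where

  lighter-load≤½ : ∀ B → load p B ≤ load p (compl B) → load p B ≤ ½
  lighter-load≤½ B B≤Bᶜ = x≤y∧x+y≤z+z⇒x≤z B≤Bᶜ (subst (_≤ 1ℚ) (sym (load-+-compl p B)) total≤1)

  compl-load≤¾ : ∀ A → ¼ < load p A → load p (compl A) ≤ ¾
  compl-load≤¾ A ¼<A = x<y∧y+z≤x+w⇒z≤w ¼<A (subst (_≤ 1ℚ) (sym (load-+-compl p A)) total≤1)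

  balanced-orientation : ∀ A → ¼ < load p A → load p A ≤ ¾
    → Σ[ S ∈ (Fin n → Bool) ] (Balanced p S × (load p S ≡ load p A ⊎ load p (compl S) ≡ load p A))
  balanced-orientation A ¼<A A≤¾ with load p A ≤? load p (compl A)
  ... | yes A≤Aᶜ = A , (lighter-load≤½ A A≤Aᶜ , compl-load≤¾ A ¼<A , A≤Aᶜ) , inj₁ refl
  ... | no A≰Aᶜ =
    compl A , (lighter-load≤½ (compl A) Aᶜ≤Aᶜᶜ , subst (_≤ ¾) (sym Aᶜᶜ≡A) A≤¾ , Aᶜ≤Aᶜᶜ) , inj₂ Aᶜᶜ≡A
    where
    Aᶜᶜ≡A : load p (compl (compl A)) ≡ load p A
    Aᶜᶜ≡A = load-compl-compl p A
    Aᶜ≤Aᶜᶜ : load p (compl A) ≤ load p (compl (compl A))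
    Aᶜ≤Aᶜᶜ = subst (load p (compl A) ≤_) (sym Aᶜᶜ≡A) (<⇒≤ (≰⇒> A≰Aᶜ))

lemma10 : (n : ℕ) (p : Fin n → ℚ)
    → (∀ j → 0ℚ ≤ p j)
    → ¾ ≤ total p
    → total p ≤ 1ℚ
    → (∀ j → p j ≤ ¾)
    → (Σ[ S ∈ (Fin n → Bool) ]
         (load p S ≤ ½ × load p (compl S) ≤ ¾ × load p S ≤ load p (compl S)))
      × ((∀ j → p j ≤ ½)
         → Σ[ S ∈ (Fin n → Bool) ]
             ((load p S ≤ ½ × load p (compl S) ≤ ¾ × load p S ≤ load p (compl S))
              × (InQuarterHalf (load p S) ⊎ InQuarterHalf (load p (compl S)))))
lemma10 n p _ ¾≤total total≤1 p≤¾ = balanced-part , balanced-part-in-window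
  where
  Window : ℚ → Set
  Window b = Σ[ A ∈ (Fin n → Bool) ] (¼ < load p A × load p A ≤ b)

  window : ∀ {b} → ½ ≤ b → (∀ j → p j ≤ b) → Window b
  window ½≤b p≤b with total≤⊎∃load∈window (toWitness {a? = 0ℚ ≤? ¼} tt) ½≤b p p≤b
  ... | inj₁ total≤¼ = ⊥-elim (<-irrefl refl (<-≤-trans ¼<¾ (≤-trans ¾≤total total≤¼)))
    where
    ¼<¾ : ¼ < ¾
    ¼<¾ = toWitness {a? = ¼ <? ¾} tt
  ... | inj₂ A-in-window = A-in-window

  ½≤¾ : ½ ≤ ¾
  ½≤¾ = toWitness {a? = ½ ≤? ¾} tt

  balanced-part : Σ[ S ∈ (Fin n → Bool) ] Balanced p S
  balanced-part with window ½≤¾ p≤¾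
  ... | A , ¼<A , A≤¾ with balanced-orientation p total≤1 A ¼<A A≤¾
  ...   | S , balanced , _ = S , balanced

  balanced-part-in-window : (∀ j → p j ≤ ½) → Σ[ S ∈ (Fin n → Bool) ]
    (Balanced p S × (InQuarterHalf (load p S) ⊎ InQuarterHalf (load p (compl S))))
  balanced-part-in-window p≤½ with window ≤-refl p≤½
  ... | A , ¼<A , A≤½ with balanced-orientation p total≤1 A ¼<A (≤-trans A≤½ ½≤¾)
  ...   | S , balanced , inj₁ S≡A  = S , balanced , inj₁ (subst InQuarterHalf (sym S≡A) (¼<A , A≤½))
  ...   | S , balanced , inj₂ Sᶜ≡A = S , balanced , inj₂ (subst InQuarterHalf (sym Sᶜ≡A) (¼<A , A≤½))
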